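{- Let $A$ be a non-empty set of atoms. For all closed terms $P,Q\in\mathcal S_A$: $\mathrm{EqFSCL}\vdash P=Q$ if and only if $\mathrm{FSCL}\vdash P=Q$.
   Context: $\mathcal S_A$ is the set of closed terms over the signature with constants $\mathsf T,\mathsf F$, $a\in A$, unary $\neg$, binary $\wedge,\vee$ (left-sequential conjunction/disjunction). $\mathrm{EqFSCL}\vdash s=t$ means derivability in equational logic from the axioms: (F1) $\mathsf F=\neg\mathsf T$; (F2) $x\vee y=\neg(\neg x\wedge\neg y)$; (F3) $\neg\neg x=x$; (F4) $\mathsf T\wedge x=x$; (F5) $x\vee\mathsf F=x$; (F6) $\mathsf F\wedge x=\mathsf F$; (F7) $(x\wedge y)\wedge z=x\wedge(y\wedge z)$; (F8) $\neg x\wedge\mathsf F=x\wedge\mathsf F$; (F9) $(x\wedge\mathsf F)\vee y=(x\vee\mathsf T)\wedge y$; (F10) $(x\wedge y)\vee(z\wedge\mathsf F)=(x\vee(z\wedge\mathsf F))\wedge(y\vee(z\wedge\mathsf F))$. Free short-circuit logic: consider the ternary conditional connective $x\triangleleft y\triangleright z$ ("if $y$ then $x$ else $z$") and the axiom set CP: (CP1) $x\triangleleft\mathsf T\triangleright y=x$; (CP2) $x\triangleleft\mathsf F\triangleright y=y$; (CP3) $\mathsf T\triangleleft x\triangleright\mathsf F=x$; (CP4) $x\triangleleft(y\triangleleft z\triangleright u)\triangleright v=(x\triangleleft y\triangleright v)\triangleleft z\triangleright(x\triangleleft u\triangleright v)$. FSCL is the logic whose consequences are exactly those of CP together with $\neg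 x=\mathsf F\triangleleft x\triangleright\mathsf T$ and $x\wedge y=y\triangleleft x\triangleright\mathsf F$, restricted to the signature $\{\mathsf T,\neg,\wedge\}$ (the conditional being a hidden operator), with $\mathsf F$ and $\vee$ added via $\mathsf F=\neg\mathsf T$ and $x\vee y=\neg(\neg x\wedge\neg y)$. Concretely, for closed $P,Q\in\mathcal S_A$, $\mathrm{FSCL}\vdash P=Q$ holds iff $P=Q$ is derivable in equational logic from CP together with $\neg x=\mathsf F\triangleleft x\triangleright\mathsf T$, $x\wedge y=y\triangleleft x\triangleright\mathsf F$ and $x\vee y=\mathsf T\triangleleft x\triangleright y$. -}

module Defs where

open import Data.Nat using (ℕ)
open import Data.Empty using (⊥; ⊥-elim)

data Term (A : Set) (V : Set) : Set where
  var  : V → Term A V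
  T F  : Term A V
  atom : A → Term A V
  ¬_   : Term A V → Term A V
  _∧_ _∨_ : Term A V → Term A V → Term A V

infix  7 ¬_
infixr 6 _∧_
infixr 5 _∨_

S : Set → Set
S A = Term A ⊥

close : {A : Set} → S A → Term A ℕ
close (var ())
close T = T
close F = F
close (atom a) = atom a
close (¬ x) = ¬ close x
close (x ∧ y) = close x ∧ close y
close (x ∨ y) = close x ∨ close y

-- EqFSCL ⊢ s = t : equational logic from axioms F1–F10.
-- Axioms are given as schemas over arbitrary terms (this is closure
-- under substitution); equivalence and congruence rules are explicit.

infix 4 EqFSCL⊢_≈_
data EqFSCL⊢_≈_ {A : Set} : Term A ℕ → Term A ℕ → Set where
  refl  : ∀ {s} → EqFSCL⊢ s ≈ s
  sym   : ∀ {s t} → EqFSCL⊢ s ≈ t → EqFSCL⊢ t ≈ s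
  trans : ∀ {s t u} → EqFSCL⊢ s ≈ t → EqFSCL⊢ t ≈ u → EqFSCL⊢ s ≈ u
  ¬-cong : ∀ {s t} → EqFSCL⊢ s ≈ t → EqFSCL⊢ ¬ s ≈ ¬ t
  ∧-cong : ∀ {s s' t t'} → EqFSCL⊢ s ≈ s' → EqFSCL⊢ t ≈ t' → EqFSCL⊢ s ∧ t ≈ s' ∧ t'
  ∨-cong : ∀ {s s' t t'} → EqFSCL⊢ s ≈ s' → EqFSCL⊢ t ≈ t' → EqFSCL⊢ s ∨ t ≈ s' ∨ t'
  F1  : EqFSCL⊢ F ≈ ¬ T
  F2  : ∀ x y → EqFSCL⊢ x ∨ y ≈ ¬ (¬ x ∧ ¬ y)
  F3  : ∀ x → EqFSCL⊢ ¬ ¬ x ≈ x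
  F4  : ∀ x → EqFSCL⊢ T ∧ x ≈ x
  F5  : ∀ x → EqFSCL⊢ x ∨ F ≈ x
  F6  : ∀ x → EqFSCL⊢ F ∧ x ≈ F
  F7  : ∀ x y z → EqFSCL⊢ (x ∧ y) ∧ z ≈ x ∧ (y ∧ z)
  F8  : ∀ x → EqFSCL⊢ ¬ x ∧ F ≈ x ∧ F
  F9  : ∀ x y → EqFSCL⊢ (x ∧ F) ∨ y ≈ (x ∨ T) ∧ y
  F10 : ∀ x y z → EqFSCL⊢ (x ∧ y) ∨ (z ∧ F) ≈ (x ∨ (z ∧ F)) ∧ (y ∨ (z ∧ F))

data CTerm (A : Set) (V : Set) : Set where
  var  : V → CTerm A V
  T F  : CTerm A V
  atom : A → CTerm A V
  ¬_   : CTerm A V → CTerm A V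
  _∧_ _∨_ : CTerm A V → CTerm A V → CTerm A V
  _◁_▷_ : CTerm A V → CTerm A V → CTerm A V → CTerm A V

⌜_⌝ : {A V : Set} → Term A V → CTerm A V
⌜ var v ⌝ = var v
⌜ T ⌝ = T
⌜ F ⌝ = F
⌜ atom a ⌝ = atom a
⌜ ¬ x ⌝ = ¬ ⌜ x ⌝
⌜ x ∧ y ⌝ = ⌜ x ⌝ ∧ ⌜ y ⌝
⌜ x ∨ y ⌝ = ⌜ x ⌝ ∨ ⌜ y ⌝

infix 4 FSCL⊢_≈_
data FSCL⊢_≈_ {A : Set} : CTerm A ℕ → CTerm A ℕ → Set where
  refl  : ∀ {s} → FSCL⊢ s ≈ s
  sym   : ∀ {s t} → FSCL⊢ s ≈ t → FSCL⊢ t ≈ s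
  trans : ∀ {s t u} → FSCL⊢ s ≈ t → FSCL⊢ t ≈ u → FSCL⊢ s ≈ u
  ¬-cong : ∀ {s t} → FSCL⊢ s ≈ t → FSCL⊢ ¬ s ≈ ¬ t
  ∧-cong : ∀ {s s' t t'} → FSCL⊢ s ≈ s' → FSCL⊢ t ≈ t' → FSCL⊢ s ∧ t ≈ s' ∧ t'
  ∨-cong : ∀ {s s' t t'} → FSCL⊢ s ≈ s' → FSCL⊢ t ≈ t' → FSCL⊢ s ∨ t ≈ s' ∨ t'
  ◁▷-cong : ∀ {s s' t t' u u'} → FSCL⊢ s ≈ s' → FSCL⊢ t ≈ t' → FSCL⊢ u ≈ u'
          → FSCL⊢ s ◁ t ▷ u ≈ s' ◁ t' ▷ u'
  CP1 : ∀ x y → FSCL⊢ x ◁ T ▷ y ≈ x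
  CP2 : ∀ x y → FSCL⊢ x ◁ F ▷ y ≈ y
  CP3 : ∀ x → FSCL⊢ T ◁ x ▷ F ≈ x
  CP4 : ∀ x y z u v → FSCL⊢ x ◁ (y ◁ z ▷ u) ▷ v ≈ (x ◁ y ▷ v) ◁ z ▷ (x ◁ u ▷ v)
  ¬-def : ∀ x → FSCL⊢ ¬ x ≈ F ◁ x ▷ T
  ∧-def : ∀ x y → FSCL⊢ x ∧ y ≈ y ◁ x ▷ F
  ∨-def : ∀ x y → FSCL⊢ x ∨ y ≈ T ◁ x ▷ y

-- Soundness: each axiom F1–F10 is derivable from CP and the defining equations of ¬, ∧, ∨.
-- Completeness: interpret terms as evaluation trees (binary trees with atoms at the nodes and
-- truth values at the leaves, x ◁ y ▷ z replacing the T- and F-leaves of the tree of y by those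
-- of x and z); FSCL derivations preserve these trees. EqFSCL proves every closed term equal to a
-- normal form: a T-term, an F-term, or a T-term followed by a canonical ∧/∨-combination of
-- literals. The tree of a normal form determines it: the T-term is the largest shape that
-- factors off the tree, and in a canonical combination every run of one connective makes the
-- exit receiving its last operand strictly larger than all others, which locates the connectives.

module Submission where

open import Defs
open import Data.Nat using (ℕ; suc; _+_; _⊔_; _≤_; _<_; s≤s)
open import Data.Nat.Properties
  using (≤-refl; ≤-trans; n≮0; <⇒≤; <-trans; ≤-<-trans; <-≤-trans; <-irrefl; <-asym; n≮n; n≤1+n; m≤m+n; m≤n+m;
         m≤m⊔n; m≤n⊔m; ⊔-lub; ⊔-comm; m≤n⇒m⊔n≡n; m≥n⇒m⊔n≡m; module ≤-Reasoning)
open import Data.Bool using (Bool; true; false; not)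
open import Data.Product using (_×_; _,_; proj₁; proj₂; uncurry; swap; map₁; ∃)
open import Data.Sum using (_⊎_; inj₁; inj₂)
open import Data.Empty using (⊥; ⊥-elim)
open import Function.Bundles using (_⇔_; mk⇔)
import Relation.Binary.PropositionalEquality as ≡
open ≡ using (_≡_; _≢_)
open import Relation.Binary.Bundles using (Setoid)
import Relation.Binary.Reasoning.Setoid as SetoidReasoning

-- Soundness

module _ {A : Set} where

  FSCL-setoid : Setoid _ _
  FSCL-setoid = record
    { Carrier = CTerm A ℕ
    ; _≈_ = FSCL⊢_≈_
    ; isEquivalence = record { refl = refl ; sym = sym ; trans = trans }
    }

  open SetoidReasoning FSCL-setoid

  infix 4 _≅_
  _≅_ : CTerm A ℕ → CTerm A ℕ → Set
  _≅_ = FSCL⊢_≈_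

  ¬¬-involutive : ∀ x → ¬ ¬ x ≅ x
  ¬¬-involutive x = begin
    ¬ ¬ x                                ≈⟨ ¬-def (¬ x) ⟩
    F ◁ ¬ x ▷ T                          ≈⟨ ◁▷-cong refl (¬-def x) refl ⟩
    F ◁ (F ◁ x ▷ T) ▷ T                  ≈⟨ CP4 F F x T T ⟩
    (F ◁ F ▷ T) ◁ x ▷ (F ◁ T ▷ T)        ≈⟨ ◁▷-cong (CP2 F T) refl (CP1 F T) ⟩
    T ◁ x ▷ F                            ≈⟨ CP3 x ⟩
    x                                    ∎

  F≅¬T : F ≅ ¬ T
  F≅¬T = sym (trans (¬-def T) (CP1 F T))

  ∨≅¬∧¬ : ∀ x y → x ∨ y ≅ ¬ (¬ x ∧ ¬ y)
  ∨≅¬∧¬ x y = sym (begin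
    ¬ (¬ x ∧ ¬ y)                                      ≈⟨ ¬-def _ ⟩
    F ◁ (¬ x ∧ ¬ y) ▷ T                                ≈⟨ ◁▷-cong refl (∧-def _ _) refl ⟩
    F ◁ ((¬ y) ◁ ¬ x ▷ F) ▷ T                          ≈⟨ ◁▷-cong refl (◁▷-cong refl (¬-def x) refl) refl ⟩
    F ◁ ((¬ y) ◁ (F ◁ x ▷ T) ▷ F) ▷ T                  ≈⟨ ◁▷-cong refl (CP4 (¬ y) F x T F) refl ⟩
    F ◁ (((¬ y) ◁ F ▷ F) ◁ x ▷ ((¬ y) ◁ T ▷ F)) ▷ T    ≈⟨ ◁▷-cong refl (◁▷-cong (CP2 _ _) refl (CP1 _ _)) refl ⟩
    F ◁ (F ◁ x ▷ (¬ y)) ▷ T                            ≈⟨ CP4 F F x (¬ y) T ⟩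
    (F ◁ F ▷ T) ◁ x ▷ (F ◁ ¬ y ▷ T)                    ≈⟨ ◁▷-cong (CP2 F T) refl (sym (¬-def (¬ y))) ⟩
    T ◁ x ▷ (¬ ¬ y)                                    ≈⟨ ◁▷-cong refl refl (¬¬-involutive y) ⟩
    T ◁ x ▷ y                                          ≈⟨ sym (∨-def x y) ⟩
    x ∨ y                                              ∎)

  ∧-assoc : ∀ x y z → (x ∧ y) ∧ z ≅ x ∧ (y ∧ z)
  ∧-assoc x y z = begin
    (x ∧ y) ∧ z                          ≈⟨ ∧-def _ _ ⟩
    z ◁ (x ∧ y) ▷ F                      ≈⟨ ◁▷-cong refl (∧-def x y) refl ⟩
    z ◁ (y ◁ x ▷ F) ▷ F                  ≈⟨ CP4 z y x F F ⟩
    (z ◁ y ▷ F) ◁ x ▷ (z ◁ F ▷ F)        ≈⟨ ◁▷-cong (sym (∧-def y z)) refl (CP2 z F) ⟩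
    (y ∧ z) ◁ x ▷ F                      ≈⟨ sym (∧-def _ _) ⟩
    x ∧ (y ∧ z)                          ∎

  ¬∧F≅∧F : ∀ x → ¬ x ∧ F ≅ x ∧ F
  ¬∧F≅∧F x = begin
    ¬ x ∧ F                              ≈⟨ ∧-def _ _ ⟩
    F ◁ ¬ x ▷ F                          ≈⟨ ◁▷-cong refl (¬-def x) refl ⟩
    F ◁ (F ◁ x ▷ T) ▷ F                  ≈⟨ CP4 F F x T F ⟩
    (F ◁ F ▷ F) ◁ x ▷ (F ◁ T ▷ F)        ≈⟨ ◁▷-cong (CP2 F F) refl (CP1 F F) ⟩
    F ◁ x ▷ F                            ≈⟨ sym (∧-def x F) ⟩
    x ∧ F                                ∎

  ∧F∨≅∨T∧ : ∀ x y → (x ∧ F) ∨ y ≅ (x ∨ T) ∧ y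
  ∧F∨≅∨T∧ x y = begin
    (x ∧ F) ∨ y                          ≈⟨ ∨-def _ _ ⟩
    T ◁ (x ∧ F) ▷ y                      ≈⟨ ◁▷-cong refl (∧-def x F) refl ⟩
    T ◁ (F ◁ x ▷ F) ▷ y                  ≈⟨ CP4 T F x F y ⟩
    (T ◁ F ▷ y) ◁ x ▷ (T ◁ F ▷ y)        ≈⟨ ◁▷-cong (CP2 T y) refl (CP2 T y) ⟩
    y ◁ x ▷ y                            ≈⟨ ◁▷-cong (sym (CP1 y F)) refl (sym (CP1 y F)) ⟩
    (y ◁ T ▷ F) ◁ x ▷ (y ◁ T ▷ F)        ≈⟨ sym (CP4 y T x T F) ⟩
    y ◁ (T ◁ x ▷ T) ▷ F                  ≈⟨ sym (◁▷-cong refl (∨-def x T) refl) ⟩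
    y ◁ (x ∨ T) ▷ F                      ≈⟨ sym (∧-def _ _) ⟩
    (x ∨ T) ∧ y                          ∎

  ∧∨∧F-distrib : ∀ x y z → (x ∧ y) ∨ (z ∧ F) ≅ (x ∨ (z ∧ F)) ∧ (y ∨ (z ∧ F))
  ∧∨∧F-distrib x y z = begin
    (x ∧ y) ∨ (z ∧ F)                    ≈⟨ ∨-def _ _ ⟩
    T ◁ (x ∧ y) ▷ (z ∧ F)                ≈⟨ ◁▷-cong refl (∧-def x y) (∧-def z F) ⟩
    T ◁ (y ◁ x ▷ F) ▷ zF                 ≈⟨ CP4 T y x F zF ⟩
    (T ◁ y ▷ zF) ◁ x ▷ (T ◁ F ▷ zF)      ≈⟨ ◁▷-cong refl refl (CP2 T zF) ⟩
    (T ◁ y ▷ zF) ◁ x ▷ zF                ≈⟨ ◁▷-cong (sym (CP1 _ F)) refl (sym zF-absorbs) ⟩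
    ((T ◁ y ▷ zF) ◁ T ▷ F) ◁ x ▷ ((T ◁ y ▷ zF) ◁ zF ▷ F)
                                         ≈⟨ sym (CP4 (T ◁ y ▷ zF) T x zF F) ⟩
    (T ◁ y ▷ zF) ◁ (T ◁ x ▷ zF) ▷ F      ≈⟨ sym (◁▷-cong (or-zF y) (or-zF x) refl) ⟩
    (y ∨ (z ∧ F)) ◁ (x ∨ (z ∧ F)) ▷ F    ≈⟨ sym (∧-def _ _) ⟩
    (x ∨ (z ∧ F)) ∧ (y ∨ (z ∧ F))        ∎
    where
    zF = F ◁ z ▷ F
    or-zF : ∀ w → w ∨ (z ∧ F) ≅ T ◁ w ▷ zF
    or-zF w = trans (∨-def _ _) (◁▷-cong refl refl (∧-def z F))
    zF-absorbs : ∀ {v} → v ◁ zF ▷ F ≅ zF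
    zF-absorbs {v} = trans (CP4 v F z F F) (◁▷-cong (CP2 v F) refl (CP2 v F))

  soundness : ∀ {s t : Term A ℕ} → EqFSCL⊢ s ≈ t → ⌜ s ⌝ ≅ ⌜ t ⌝
  soundness refl = refl
  soundness (sym p) = sym (soundness p)
  soundness (trans p q) = trans (soundness p) (soundness q)
  soundness (¬-cong p) = ¬-cong (soundness p)
  soundness (∧-cong p q) = ∧-cong (soundness p) (soundness q)
  soundness (∨-cong p q) = ∨-cong (soundness p) (soundness q)
  soundness F1 = F≅¬T
  soundness (F2 x y) = ∨≅¬∧¬ _ _
  soundness (F3 x) = ¬¬-involutive _
  soundness (F4 x) = trans (∧-def T _) (CP1 _ F)
  soundness (F5 x) = trans (∨-def _ F) (CP3 _)
  soundness (F6 x) = trans (∧-def F _) (CP2 _ F)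
  soundness (F7 x y z) = ∧-assoc _ _ _
  soundness (F8 x) = ¬∧F≅∧F _
  soundness (F9 x y) = ∧F∨≅∨T∧ _ _
  soundness (F10 x y z) = ∧∨∧F-distrib _ _ _

-- Evaluation trees

data Tree (A : Set) : Set where
  leaf : Bool → Tree A
  node : A → Tree A → Tree A → Tree A

module _ {A : Set} where

  Tᵗ Fᵗ : Tree A
  Tᵗ = leaf true
  Fᵗ = leaf false

  infix 8 _[_∣_]
  _[_∣_] : Tree A → Tree A → Tree A → Tree A
  leaf true [ x ∣ y ] = x
  leaf false [ x ∣ y ] = y
  node a l r [ x ∣ y ] = node a (l [ x ∣ y ]) (r [ x ∣ y ])

  [Tᵗ∣Fᵗ] : ∀ t → t [ Tᵗ ∣ Fᵗ ] ≡ t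
  [Tᵗ∣Fᵗ] (leaf true) = ≡.refl
  [Tᵗ∣Fᵗ] (leaf false) = ≡.refl
  [Tᵗ∣Fᵗ] (node a l r) = ≡.cong₂ (node a) ([Tᵗ∣Fᵗ] l) ([Tᵗ∣Fᵗ] r)

  [∣]-assoc : ∀ t y u x v → t [ y ∣ u ] [ x ∣ v ] ≡ t [ y [ x ∣ v ] ∣ u [ x ∣ v ] ]
  [∣]-assoc (leaf true) y u x v = ≡.refl
  [∣]-assoc (leaf false) y u x v = ≡.refl
  [∣]-assoc (node a l r) y u x v = ≡.cong₂ (node a) ([∣]-assoc l y u x v) ([∣]-assoc r y u x v)

  [∣]-cong : ∀ {t t′ x x′ y y′} → t ≡ t′ → x ≡ x′ → y ≡ y′ → t [ x ∣ y ] ≡ t′ [ x′ ∣ y′ ]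
  [∣]-cong ≡.refl ≡.refl ≡.refl = ≡.refl

  eval : (ℕ → Tree A) → CTerm A ℕ → Tree A
  eval γ (var v) = γ v
  eval γ T = Tᵗ
  eval γ F = Fᵗ
  eval γ (atom a) = node a Tᵗ Fᵗ
  eval γ (¬ x) = eval γ x [ Fᵗ ∣ Tᵗ ]
  eval γ (x ∧ y) = eval γ x [ eval γ y ∣ Fᵗ ]
  eval γ (x ∨ y) = eval γ x [ Tᵗ ∣ eval γ y ]
  eval γ (x ◁ y ▷ z) = eval γ y [ eval γ x ∣ eval γ z ]

  eval-sound : ∀ γ {s t} → s ≅ t → eval γ s ≡ eval γ t
  eval-sound γ refl = ≡.refl
  eval-sound γ (sym p) = ≡.sym (eval-sound γ p)
  eval-sound γ (trans p q) = ≡.trans (eval-sound γ p) (eval-sound γ q)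
  eval-sound γ (¬-cong p) = ≡.cong _[ Fᵗ ∣ Tᵗ ] (eval-sound γ p)
  eval-sound γ (∧-cong p q) = ≡.cong₂ _[_∣ Fᵗ ] (eval-sound γ p) (eval-sound γ q)
  eval-sound γ (∨-cong p q) = ≡.cong₂ _[ Tᵗ ∣_] (eval-sound γ p) (eval-sound γ q)
  eval-sound γ (◁▷-cong p q r) = [∣]-cong (eval-sound γ q) (eval-sound γ p) (eval-sound γ r)
  eval-sound γ (CP1 x y) = ≡.refl
  eval-sound γ (CP2 x y) = ≡.refl
  eval-sound γ (CP3 x) = [Tᵗ∣Fᵗ] (eval γ x)
  eval-sound γ (CP4 x y z u v) = [∣]-assoc (eval γ z) (eval γ y) (eval γ u) (eval γ x) (eval γ v)
  eval-sound γ (¬-def x) = ≡.refl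
  eval-sound γ (∧-def x y) = ≡.refl
  eval-sound γ (∨-def x y) = ≡.refl

-- Normal forms

module Normalisation (A : Set) where

  infix 4 _≃_
  _≃_ : Term A ℕ → Term A ℕ → Set
  _≃_ = EqFSCL⊢_≈_

  EqFSCL-setoid : Setoid _ _
  EqFSCL-setoid = record
    { Carrier = Term A ℕ
    ; _≈_ = _≃_
    ; isEquivalence = record { refl = refl ; sym = sym ; trans = trans }
    }

  open SetoidReasoning EqFSCL-setoid

  ¬T≃F : ¬ T ≃ F
  ¬T≃F = sym F1

  ¬F≃T : ¬ F ≃ T
  ¬F≃T = trans (¬-cong F1) (F3 T)

  ¬-∨ : ∀ x y → ¬ (x ∨ y) ≃ ¬ x ∧ ¬ y
  ¬-∨ x y = trans (¬-cong (F2 x y)) (F3 _)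

  ¬-∧ : ∀ x y → ¬ (x ∧ y) ≃ ¬ x ∨ ¬ y
  ¬-∧ x y = sym (trans (F2 (¬ x) (¬ y)) (¬-cong (∧-cong (F3 x) (F3 y))))

  ∧-identityʳ : ∀ x → x ∧ T ≃ x
  ∧-identityʳ x = begin
    x ∧ T            ≈⟨ ∧-cong (sym (F3 x)) (sym ¬F≃T) ⟩
    ¬ ¬ x ∧ ¬ F      ≈⟨ sym (¬-∨ (¬ x) F) ⟩
    ¬ (¬ x ∨ F)      ≈⟨ ¬-cong (F5 _) ⟩
    ¬ ¬ x            ≈⟨ F3 x ⟩
    x                ∎

  ∨-assoc : ∀ x y z → (x ∨ y) ∨ z ≃ x ∨ (y ∨ z)
  ∨-assoc x y z = begin
    (x ∨ y) ∨ z               ≈⟨ F2 _ _ ⟩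
    ¬ (¬ (x ∨ y) ∧ ¬ z)       ≈⟨ ¬-cong (∧-cong (¬-∨ x y) refl) ⟩
    ¬ ((¬ x ∧ ¬ y) ∧ ¬ z)     ≈⟨ ¬-cong (F7 _ _ _) ⟩
    ¬ (¬ x ∧ (¬ y ∧ ¬ z))     ≈⟨ ¬-cong (∧-cong refl (sym (¬-∨ y z))) ⟩
    ¬ (¬ x ∧ ¬ (y ∨ z))       ≈⟨ sym (F2 _ _) ⟩
    x ∨ (y ∨ z)               ∎

  ∨-zeroˡ : ∀ x → T ∨ x ≃ T
  ∨-zeroˡ x = begin
    T ∨ x            ≈⟨ F2 _ _ ⟩
    ¬ (¬ T ∧ ¬ x)    ≈⟨ ¬-cong (∧-cong ¬T≃F refl) ⟩
    ¬ (F ∧ ¬ x)      ≈⟨ ¬-cong (F6 _) ⟩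
    ¬ F              ≈⟨ ¬F≃T ⟩
    T                ∎

  ∨T-¬∧F : ∀ z → ¬ (¬ z ∧ F) ≃ z ∨ T
  ∨T-¬∧F z = trans (¬-∧ (¬ z) F) (∨-cong (F3 z) ¬F≃T)

  F10-dual : ∀ x y z → (x ∨ y) ∧ (z ∨ T) ≃ (x ∧ (z ∨ T)) ∨ (y ∧ (z ∨ T))
  F10-dual x y z = begin
    (x ∨ y) ∧ (z ∨ T)                                 ≈⟨ ∧-cong (F2 x y) (sym (∨T-¬∧F z)) ⟩
    ¬ (¬ x ∧ ¬ y) ∧ ¬ (¬ z ∧ F)                       ≈⟨ sym (¬-∨ _ _) ⟩
    ¬ ((¬ x ∧ ¬ y) ∨ (¬ z ∧ F))                       ≈⟨ ¬-cong (F10 (¬ x) (¬ y) (¬ z)) ⟩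
    ¬ ((¬ x ∨ (¬ z ∧ F)) ∧ (¬ y ∨ (¬ z ∧ F)))         ≈⟨ ¬-∧ _ _ ⟩
    ¬ (¬ x ∨ (¬ z ∧ F)) ∨ ¬ (¬ y ∨ (¬ z ∧ F))         ≈⟨ ∨-cong (dual x) (dual y) ⟩
    (x ∧ (z ∨ T)) ∨ (y ∧ (z ∨ T))                     ∎
    where
    dual : ∀ w → ¬ (¬ w ∨ (¬ z ∧ F)) ≃ w ∧ (z ∨ T)
    dual w = trans (¬-∨ _ _) (∧-cong (F3 w) (∨T-¬∧F z))

  data TShape : Set where
    tip : TShape
    branch : A → TShape → TShape → TShape

  ⟦_⟧ᵀ ⟦_⟧ᶠ : TShape → Term A ℕ
  ⟦ tip ⟧ᵀ = T
  ⟦ branch a l r ⟧ᵀ = (atom a ∧ ⟦ l ⟧ᵀ) ∨ ⟦ r ⟧ᵀ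
  ⟦ s ⟧ᶠ = ⟦ s ⟧ᵀ ∧ F

  infixr 6 _⨟_
  _⨟_ : TShape → TShape → TShape
  tip ⨟ u = u
  branch a l r ⨟ u = branch a (l ⨟ u) (r ⨟ u)

  ⨟-identityʳ : ∀ s → s ⨟ tip ≡ s
  ⨟-identityʳ tip = ≡.refl
  ⨟-identityʳ (branch a l r) = ≡.cong₂ (branch a) (⨟-identityʳ l) (⨟-identityʳ r)

  ∨-zeroˡᵀ : ∀ s y → ⟦ s ⟧ᵀ ∨ y ≃ ⟦ s ⟧ᵀ
  ∨-zeroˡᵀ tip y = ∨-zeroˡ y
  ∨-zeroˡᵀ (branch a l r) y = trans (∨-assoc _ _ _) (∨-cong refl (∨-zeroˡᵀ r y))

  ∧-zeroˡᶠ : ∀ s y → ⟦ s ⟧ᶠ ∧ y ≃ ⟦ s ⟧ᶠ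
  ∧-zeroˡᶠ s y = trans (F7 _ F y) (∧-cong refl (F6 y))

  ¬ᵀ : ∀ s → ¬ ⟦ s ⟧ᵀ ≃ ⟦ s ⟧ᶠ
  ¬ᵀ s = begin
    ¬ ⟦ s ⟧ᵀ            ≈⟨ ¬-cong (sym (∨-zeroˡᵀ s T)) ⟩
    ¬ (⟦ s ⟧ᵀ ∨ T)      ≈⟨ ¬-∨ _ _ ⟩
    ¬ ⟦ s ⟧ᵀ ∧ ¬ T      ≈⟨ ∧-cong refl ¬T≃F ⟩
    ¬ ⟦ s ⟧ᵀ ∧ F        ≈⟨ F8 _ ⟩
    ⟦ s ⟧ᶠ              ∎

  ᶠ∨≃ᵀ∧ : ∀ s y → ⟦ s ⟧ᶠ ∨ y ≃ ⟦ s ⟧ᵀ ∧ y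
  ᶠ∨≃ᵀ∧ s y = trans (F9 _ y) (∧-cong (∨-zeroˡᵀ s T) refl)

  ¬ᶠ : ∀ s → ¬ ⟦ s ⟧ᶠ ≃ ⟦ s ⟧ᵀ
  ¬ᶠ s = begin
    ¬ ⟦ s ⟧ᶠ            ≈⟨ ¬-∧ _ _ ⟩
    ¬ ⟦ s ⟧ᵀ ∨ ¬ F      ≈⟨ ∨-cong (¬ᵀ s) ¬F≃T ⟩
    ⟦ s ⟧ᶠ ∨ T          ≈⟨ ᶠ∨≃ᵀ∧ s T ⟩
    ⟦ s ⟧ᵀ ∧ T          ≈⟨ ∧-identityʳ _ ⟩
    ⟦ s ⟧ᵀ              ∎

  ∧-distribʳ-∨ᵀ : ∀ x y u → (x ∨ y) ∧ ⟦ u ⟧ᵀ ≃ (x ∧ ⟦ u ⟧ᵀ) ∨ (y ∧ ⟦ u ⟧ᵀ)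
  ∧-distribʳ-∨ᵀ x y u = begin
    (x ∨ y) ∧ ⟦ u ⟧ᵀ                          ≈⟨ ∧-cong refl (sym (∨-zeroˡᵀ u T)) ⟩
    (x ∨ y) ∧ (⟦ u ⟧ᵀ ∨ T)                    ≈⟨ F10-dual x y ⟦ u ⟧ᵀ ⟩
    (x ∧ (⟦ u ⟧ᵀ ∨ T)) ∨ (y ∧ (⟦ u ⟧ᵀ ∨ T))
      ≈⟨ ∨-cong (∧-cong refl (∨-zeroˡᵀ u T)) (∧-cong refl (∨-zeroˡᵀ u T)) ⟩
    (x ∧ ⟦ u ⟧ᵀ) ∨ (y ∧ ⟦ u ⟧ᵀ)               ∎

  ∧-⨟ : ∀ s u → ⟦ s ⟧ᵀ ∧ ⟦ u ⟧ᵀ ≃ ⟦ s ⨟ u ⟧ᵀ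
  ∧-⨟ tip u = F4 _
  ∧-⨟ (branch a l r) u = begin
    ((atom a ∧ ⟦ l ⟧ᵀ) ∨ ⟦ r ⟧ᵀ) ∧ ⟦ u ⟧ᵀ              ≈⟨ ∧-distribʳ-∨ᵀ _ _ u ⟩
    ((atom a ∧ ⟦ l ⟧ᵀ) ∧ ⟦ u ⟧ᵀ) ∨ (⟦ r ⟧ᵀ ∧ ⟦ u ⟧ᵀ)
      ≈⟨ ∨-cong (trans (F7 _ _ _) (∧-cong refl (∧-⨟ l u))) (∧-⨟ r u) ⟩
    (atom a ∧ ⟦ l ⨟ u ⟧ᵀ) ∨ ⟦ r ⨟ u ⟧ᵀ                 ∎

  ∧-⨟ᶠ : ∀ s u → ⟦ s ⟧ᵀ ∧ ⟦ u ⟧ᶠ ≃ ⟦ s ⨟ u ⟧ᶠ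
  ∧-⨟ᶠ s u = trans (sym (F7 _ _ _)) (∧-cong (∧-⨟ s u) refl)

  signed : Bool → A → Term A ℕ
  signed true a = atom a
  signed false a = ¬ atom a

  guarded : Term A ℕ → TShape → TShape → Term A ℕ
  guarded l s t = (l ∧ ⟦ s ⟧ᵀ) ∨ ⟦ t ⟧ᶠ

  data Literal : Set where
    literal : Bool → A → TShape → TShape → Literal

  ⟦_⟧ˡ : Literal → Term A ℕ
  ⟦ literal b a s t ⟧ˡ = guarded (signed b a) s t

  ¬-guarded : ∀ l s t → ¬ guarded l s t ≃ guarded (¬ l) t s
  ¬-guarded l s t = begin
    ¬ ((l ∧ ⟦ s ⟧ᵀ) ∨ ⟦ t ⟧ᶠ)            ≈⟨ ¬-∨ _ _ ⟩
    ¬ (l ∧ ⟦ s ⟧ᵀ) ∧ ¬ ⟦ t ⟧ᶠ            ≈⟨ ∧-cong (trans (¬-∧ _ _) (∨-cong refl (¬ᵀ s))) (¬ᶠ t) ⟩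
    (¬ l ∨ ⟦ s ⟧ᶠ) ∧ ⟦ t ⟧ᵀ              ≈⟨ ∧-cong refl (sym (∨-zeroˡᵀ t _)) ⟩
    (¬ l ∨ ⟦ s ⟧ᶠ) ∧ (⟦ t ⟧ᵀ ∨ ⟦ s ⟧ᶠ)   ≈⟨ sym (F10 (¬ l) ⟦ t ⟧ᵀ ⟦ s ⟧ᵀ) ⟩
    (¬ l ∧ ⟦ t ⟧ᵀ) ∨ ⟦ s ⟧ᶠ              ∎

  negˡ : Literal → Literal
  negˡ (literal b a s t) = literal (not b) a t s

  ¬ˡ : ∀ ℓ → ¬ ⟦ ℓ ⟧ˡ ≃ ⟦ negˡ ℓ ⟧ˡ
  ¬ˡ (literal true a s t) = ¬-guarded (atom a) s t
  ¬ˡ (literal false a s t) = trans (¬-guarded (¬ atom a) s t) (∨-cong (∧-cong (F3 _) refl) refl)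

  infixl 6 _∧ᵀˡ_ _∧ᵀ_
  _∧ᵀˡ_ : Literal → TShape → Literal
  literal b a s t ∧ᵀˡ u = literal b a (s ⨟ u) t

  ∧ᵀˡ-correct : ∀ ℓ u → ⟦ ℓ ⟧ˡ ∧ ⟦ u ⟧ᵀ ≃ ⟦ ℓ ∧ᵀˡ u ⟧ˡ
  ∧ᵀˡ-correct (literal b a s t) u =
    trans (∧-distribʳ-∨ᵀ _ _ u) (∨-cong (trans (F7 _ _ _) (∧-cong refl (∧-⨟ s u))) (∧-zeroˡᶠ t _))

  data Formula : Set where
    lit : Literal → Formula
    and or : Formula → Formula → Formula

  ⟦_⟧ : Formula → Term A ℕ
  ⟦ lit ℓ ⟧ = ⟦ ℓ ⟧ˡ
  ⟦ and x y ⟧ = ⟦ x ⟧ ∧ ⟦ y ⟧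
  ⟦ or x y ⟧ = ⟦ x ⟧ ∨ ⟦ y ⟧

  negate : Formula → Formula
  negate (lit ℓ) = lit (negˡ ℓ)
  negate (and x y) = or (negate x) (negate y)
  negate (or x y) = and (negate x) (negate y)

  ¬-negate : ∀ x → ¬ ⟦ x ⟧ ≃ ⟦ negate x ⟧
  ¬-negate (lit ℓ) = ¬ˡ ℓ
  ¬-negate (and x y) = trans (¬-∧ _ _) (∨-cong (¬-negate x) (¬-negate y))
  ¬-negate (or x y) = trans (¬-∨ _ _) (∧-cong (¬-negate x) (¬-negate y))

  _∧ᵀ_ : Formula → TShape → Formula
  lit ℓ ∧ᵀ u = lit (ℓ ∧ᵀˡ u)
  and x y ∧ᵀ u = and x (y ∧ᵀ u)
  or x y ∧ᵀ u = or (x ∧ᵀ u) (y ∧ᵀ u)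

  ∧ᵀ-correct : ∀ x u → ⟦ x ⟧ ∧ ⟦ u ⟧ᵀ ≃ ⟦ x ∧ᵀ u ⟧
  ∧ᵀ-correct (lit ℓ) u = ∧ᵀˡ-correct ℓ u
  ∧ᵀ-correct (and x y) u = trans (F7 _ _ _) (∧-cong refl (∧ᵀ-correct y u))
  ∧ᵀ-correct (or x y) u = trans (∧-distribʳ-∨ᵀ _ _ u) (∨-cong (∧ᵀ-correct x u) (∧ᵀ-correct y u))

  -- x, continued by the F-term of s₁ if x yields T and by that of s₂ if it yields F
  ifᶠ : Term A ℕ → TShape → TShape → Term A ℕ
  ifᶠ x s₁ s₂ = (x ∨ ⟦ s₂ ⟧ᶠ) ∧ ⟦ s₁ ⟧ᶠ

  ifᶠ-∧ : ∀ x y s₁ s₂ → ifᶠ (x ∧ y) s₁ s₂ ≃ (x ∨ ⟦ s₂ ⟧ᶠ) ∧ ifᶠ y s₁ s₂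
  ifᶠ-∧ x y s₁ s₂ = trans (∧-cong (F10 x y ⟦ s₂ ⟧ᵀ) refl) (F7 _ _ _)

  ifᶠ-¬ : ∀ x s₁ s₂ → ifᶠ (¬ x) s₁ s₂ ≃ ifᶠ x s₂ s₁
  ifᶠ-¬ x s₁ s₂ = begin
    (¬ x ∨ ⟦ s₂ ⟧ᶠ) ∧ ⟦ s₁ ⟧ᶠ                     ≈⟨ sym (F7 _ _ _) ⟩
    ((¬ x ∨ ⟦ s₂ ⟧ᶠ) ∧ ⟦ s₁ ⟧ᵀ) ∧ F               ≈⟨ sym (F8 _) ⟩
    ¬ ((¬ x ∨ ⟦ s₂ ⟧ᶠ) ∧ ⟦ s₁ ⟧ᵀ) ∧ F             ≈⟨ ∧-cong (¬-∧ _ _) refl ⟩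
    (¬ (¬ x ∨ ⟦ s₂ ⟧ᶠ) ∨ ¬ ⟦ s₁ ⟧ᵀ) ∧ F           ≈⟨ ∧-cong (∨-cong ¬¬x∨ (¬ᵀ s₁)) refl ⟩
    ((x ∧ ⟦ s₂ ⟧ᵀ) ∨ ⟦ s₁ ⟧ᶠ) ∧ F                 ≈⟨ ∧-cong (F10 _ _ _) refl ⟩
    ((x ∨ ⟦ s₁ ⟧ᶠ) ∧ (⟦ s₂ ⟧ᵀ ∨ ⟦ s₁ ⟧ᶠ)) ∧ F     ≈⟨ ∧-cong (∧-cong refl (∨-zeroˡᵀ s₂ _)) refl ⟩
    ((x ∨ ⟦ s₁ ⟧ᶠ) ∧ ⟦ s₂ ⟧ᵀ) ∧ F                 ≈⟨ F7 _ _ _ ⟩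
    (x ∨ ⟦ s₁ ⟧ᶠ) ∧ ⟦ s₂ ⟧ᶠ                       ∎
    where
    ¬¬x∨ : ¬ (¬ x ∨ ⟦ s₂ ⟧ᶠ) ≃ x ∧ ⟦ s₂ ⟧ᵀ
    ¬¬x∨ = trans (¬-∨ _ _) (∧-cong (F3 x) (¬ᶠ s₂))

  ifᶠ-∨ : ∀ x y s₁ s₂ → ifᶠ (x ∨ y) s₁ s₂ ≃ (¬ x ∨ ⟦ s₁ ⟧ᶠ) ∧ ifᶠ y s₁ s₂
  ifᶠ-∨ x y s₁ s₂ = begin
    ifᶠ (x ∨ y) s₁ s₂                  ≈⟨ ∧-cong (∨-cong (F2 x y) refl) refl ⟩
    ifᶠ (¬ (¬ x ∧ ¬ y)) s₁ s₂          ≈⟨ ifᶠ-¬ _ s₁ s₂ ⟩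
    ifᶠ (¬ x ∧ ¬ y) s₂ s₁              ≈⟨ ifᶠ-∧ _ _ s₂ s₁ ⟩
    (¬ x ∨ ⟦ s₁ ⟧ᶠ) ∧ ifᶠ (¬ y) s₂ s₁  ≈⟨ ∧-cong refl (ifᶠ-¬ y s₂ s₁) ⟩
    (¬ x ∨ ⟦ s₁ ⟧ᶠ) ∧ ifᶠ y s₁ s₂      ∎

  ifᶠ-ᵀ : ∀ s s₁ s₂ → ifᶠ ⟦ s ⟧ᵀ s₁ s₂ ≃ ⟦ s ⨟ s₁ ⟧ᶠ
  ifᶠ-ᵀ s s₁ s₂ = trans (∧-cong (∨-zeroˡᵀ s _) refl) (∧-⨟ᶠ s s₁)

  ifᶠ-ᶠ : ∀ t s₁ s₂ → ifᶠ ⟦ t ⟧ᶠ s₁ s₂ ≃ ⟦ t ⨟ s₂ ⟧ᶠ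
  ifᶠ-ᶠ t s₁ s₂ = begin
    (⟦ t ⟧ᶠ ∨ ⟦ s₂ ⟧ᶠ) ∧ ⟦ s₁ ⟧ᶠ     ≈⟨ ∧-cong (ᶠ∨≃ᵀ∧ t _) refl ⟩
    (⟦ t ⟧ᵀ ∧ ⟦ s₂ ⟧ᶠ) ∧ ⟦ s₁ ⟧ᶠ     ≈⟨ F7 _ _ _ ⟩
    ⟦ t ⟧ᵀ ∧ (⟦ s₂ ⟧ᶠ ∧ ⟦ s₁ ⟧ᶠ)     ≈⟨ ∧-cong refl (∧-zeroˡᶠ s₂ _) ⟩
    ⟦ t ⟧ᵀ ∧ ⟦ s₂ ⟧ᶠ                 ≈⟨ ∧-⨟ᶠ t s₂ ⟩
    ⟦ t ⨟ s₂ ⟧ᶠ                      ∎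

  ifᶠ-tip : ∀ x → ifᶠ x tip tip ≃ x ∧ F
  ifᶠ-tip x = ∧-cong (trans (∨-cong refl (F4 F)) (F5 x)) (F4 F)

  ifᶠ-guarded : ∀ l s t s₁ s₂ → ifᶠ (guarded l s t) s₁ s₂ ≃ ifᶠ l (s ⨟ s₁) (t ⨟ s₂)
  ifᶠ-guarded l s t s₁ s₂ = begin
    ifᶠ ((l ∧ ⟦ s ⟧ᵀ) ∨ ⟦ t ⟧ᶠ) s₁ s₂               ≈⟨ ifᶠ-∨ _ _ s₁ s₂ ⟩
    (¬ (l ∧ ⟦ s ⟧ᵀ) ∨ ⟦ s₁ ⟧ᶠ) ∧ ifᶠ ⟦ t ⟧ᶠ s₁ s₂  ≈⟨ ∧-cong refl (ifᶠ-ᶠ t s₁ s₂) ⟩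
    ifᶠ (¬ (l ∧ ⟦ s ⟧ᵀ)) (t ⨟ s₂) s₁               ≈⟨ ifᶠ-¬ _ _ _ ⟩
    ifᶠ (l ∧ ⟦ s ⟧ᵀ) s₁ (t ⨟ s₂)                   ≈⟨ ifᶠ-∧ _ _ _ _ ⟩
    (l ∨ ⟦ t ⨟ s₂ ⟧ᶠ) ∧ ifᶠ ⟦ s ⟧ᵀ s₁ (t ⨟ s₂)     ≈⟨ ∧-cong refl (ifᶠ-ᵀ s s₁ _) ⟩
    ifᶠ l (s ⨟ s₁) (t ⨟ s₂)                        ∎

  ifᶠ-atom : ∀ a v w → ifᶠ (atom a) v w ≃ ⟦ branch a v w ⟧ᶠ
  ifᶠ-atom a v w = sym (≡.subst₂ (λ v′ w′ → ⟦ branch a v w ⟧ᶠ ≃ ifᶠ (atom a) v′ w′)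
                                 (⨟-identityʳ v) (⨟-identityʳ w) (begin
    ⟦ branch a v w ⟧ᶠ                                      ≈⟨ sym (ifᶠ-tip _) ⟩
    ifᶠ ⟦ branch a v w ⟧ᵀ tip tip                          ≈⟨ ifᶠ-∨ _ _ tip tip ⟩
    (¬ (atom a ∧ ⟦ v ⟧ᵀ) ∨ ⟦ tip ⟧ᶠ) ∧ ifᶠ ⟦ w ⟧ᵀ tip tip  ≈⟨ ∧-cong refl (ifᶠ-ᵀ w tip tip) ⟩
    ifᶠ (¬ (atom a ∧ ⟦ v ⟧ᵀ)) (w ⨟ tip) tip                ≈⟨ ifᶠ-¬ _ _ _ ⟩
    ifᶠ (atom a ∧ ⟦ v ⟧ᵀ) tip (w ⨟ tip)                    ≈⟨ ifᶠ-∧ _ _ _ _ ⟩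
    (atom a ∨ ⟦ w ⨟ tip ⟧ᶠ) ∧ ifᶠ ⟦ v ⟧ᵀ tip (w ⨟ tip)     ≈⟨ ∧-cong refl (ifᶠ-ᵀ v tip _) ⟩
    ifᶠ (atom a) (v ⨟ tip) (w ⨟ tip)                       ∎))

  collapseˡ : Literal → TShape → TShape → TShape
  collapseˡ (literal true a s t) s₁ s₂ = branch a (s ⨟ s₁) (t ⨟ s₂)
  collapseˡ (literal false a s t) s₁ s₂ = branch a (t ⨟ s₂) (s ⨟ s₁)

  ifᶠ-literal : ∀ ℓ s₁ s₂ → ifᶠ ⟦ ℓ ⟧ˡ s₁ s₂ ≃ ⟦ collapseˡ ℓ s₁ s₂ ⟧ᶠ
  ifᶠ-literal (literal true a s t) s₁ s₂ =
    trans (ifᶠ-guarded _ s t s₁ s₂) (ifᶠ-atom a _ _)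
  ifᶠ-literal (literal false a s t) s₁ s₂ =
    trans (ifᶠ-guarded _ s t s₁ s₂) (trans (ifᶠ-¬ _ _ _) (ifᶠ-atom a _ _))

  collapse : Formula → TShape → TShape → TShape
  collapse (lit ℓ) s₁ s₂ = collapseˡ ℓ s₁ s₂
  collapse (and x y) s₁ s₂ = collapse x (collapse y s₁ s₂) s₂
  collapse (or x y) s₁ s₂ = collapse x s₁ (collapse y s₁ s₂)

  ifᶠ-collapse : ∀ x s₁ s₂ → ifᶠ ⟦ x ⟧ s₁ s₂ ≃ ⟦ collapse x s₁ s₂ ⟧ᶠ
  ifᶠ-collapse (lit ℓ) s₁ s₂ = ifᶠ-literal ℓ s₁ s₂
  ifᶠ-collapse (and x y) s₁ s₂ =
    trans (ifᶠ-∧ _ _ s₁ s₂) (trans (∧-cong refl (ifᶠ-collapse y s₁ s₂)) (ifᶠ-collapse x _ s₂))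
  ifᶠ-collapse (or x y) s₁ s₂ =
    trans (ifᶠ-∨ _ _ s₁ s₂) (trans (∧-cong refl (ifᶠ-collapse y s₁ s₂))
      (trans (ifᶠ-¬ _ _ _) (ifᶠ-collapse x s₁ _)))

  ∧ᶠ-collapse : ∀ x u → ⟦ x ⟧ ∧ ⟦ u ⟧ᶠ ≃ ⟦ collapse x u tip ⟧ᶠ
  ∧ᶠ-collapse x u = trans (∧-cong (sym (trans (∨-cong refl (F4 F)) (F5 _))) refl) (ifᶠ-collapse x u tip)

  data NF (Φ : Set) : Set where
    T-nf F-nf : TShape → NF Φ
    ∧-nf : TShape → Φ → NF Φ

  nfTerm : {Φ : Set} → (Φ → Term A ℕ) → NF Φ → Term A ℕ
  nfTerm ⟦_⟧ᵠ (T-nf s) = ⟦ s ⟧ᵀ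
  nfTerm ⟦_⟧ᵠ (F-nf s) = ⟦ s ⟧ᶠ
  nfTerm ⟦_⟧ᵠ (∧-nf s φ) = ⟦ s ⟧ᵀ ∧ ⟦ φ ⟧ᵠ

  ¬ᴺ : NF Formula → NF Formula
  ¬ᴺ (T-nf s) = F-nf s
  ¬ᴺ (F-nf s) = T-nf s
  ¬ᴺ (∧-nf s x) = ∧-nf s (negate x)

  ¬ᴺ-correct : ∀ n → ¬ nfTerm ⟦_⟧ n ≃ nfTerm ⟦_⟧ (¬ᴺ n)
  ¬ᴺ-correct (T-nf s) = ¬ᵀ s
  ¬ᴺ-correct (F-nf s) = ¬ᶠ s
  ¬ᴺ-correct (∧-nf s x) = trans (¬-∧ _ _) (trans (∨-cong (¬ᵀ s) (¬-negate x)) (ᶠ∨≃ᵀ∧ s _))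

  _∧ᴺ_ : NF Formula → NF Formula → NF Formula
  T-nf s ∧ᴺ T-nf u = T-nf (s ⨟ u)
  T-nf s ∧ᴺ F-nf u = F-nf (s ⨟ u)
  T-nf s ∧ᴺ ∧-nf u y = ∧-nf (s ⨟ u) y
  F-nf s ∧ᴺ m = F-nf s
  ∧-nf s x ∧ᴺ T-nf u = ∧-nf s (x ∧ᵀ u)
  ∧-nf s x ∧ᴺ F-nf u = F-nf (s ⨟ collapse x u tip)
  ∧-nf s x ∧ᴺ ∧-nf u y = ∧-nf s (and (x ∧ᵀ u) y)

  ∧ᴺ-correct : ∀ n m → nfTerm ⟦_⟧ n ∧ nfTerm ⟦_⟧ m ≃ nfTerm ⟦_⟧ (n ∧ᴺ m)
  ∧ᴺ-correct (T-nf s) (T-nf u) = ∧-⨟ s u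
  ∧ᴺ-correct (T-nf s) (F-nf u) = ∧-⨟ᶠ s u
  ∧ᴺ-correct (T-nf s) (∧-nf u y) = trans (sym (F7 _ _ _)) (∧-cong (∧-⨟ s u) refl)
  ∧ᴺ-correct (F-nf s) m = ∧-zeroˡᶠ s _
  ∧ᴺ-correct (∧-nf s x) (T-nf u) = trans (F7 _ _ _) (∧-cong refl (∧ᵀ-correct x u))
  ∧ᴺ-correct (∧-nf s x) (F-nf u) =
    trans (F7 _ _ _) (trans (∧-cong refl (∧ᶠ-collapse x u)) (∧-⨟ᶠ s _))
  ∧ᴺ-correct (∧-nf s x) (∧-nf u y) =
    trans (F7 _ _ _) (∧-cong refl (trans (sym (F7 _ _ _)) (∧-cong (∧ᵀ-correct x u) refl)))

  normalise : S A → NF Formula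
  normalise (var ())
  normalise T = T-nf tip
  normalise F = F-nf tip
  normalise (atom a) = ∧-nf tip (lit (literal true a tip tip))
  normalise (¬ x) = ¬ᴺ (normalise x)
  normalise (x ∧ y) = normalise x ∧ᴺ normalise y
  normalise (x ∨ y) = ¬ᴺ (¬ᴺ (normalise x) ∧ᴺ ¬ᴺ (normalise y))

  ¬-normalise : ∀ P → close P ≃ nfTerm ⟦_⟧ (normalise P) → ¬ close P ≃ nfTerm ⟦_⟧ (¬ᴺ (normalise P))
  ¬-normalise P p = trans (¬-cong p) (¬ᴺ-correct (normalise P))

  normalise-correct : ∀ P → close P ≃ nfTerm ⟦_⟧ (normalise P)
  normalise-correct (var ())
  normalise-correct T = refl
  normalise-correct F = sym (F4 F)
  normalise-correct (atom a) = sym (begin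
    T ∧ ((atom a ∧ T) ∨ (T ∧ F))  ≈⟨ F4 _ ⟩
    (atom a ∧ T) ∨ (T ∧ F)        ≈⟨ ∨-cong (∧-identityʳ _) (F4 F) ⟩
    atom a ∨ F                    ≈⟨ F5 _ ⟩
    atom a                        ∎)
  normalise-correct (¬ x) = ¬-normalise x (normalise-correct x)
  normalise-correct (x ∧ y) =
    trans (∧-cong (normalise-correct x) (normalise-correct y)) (∧ᴺ-correct (normalise x) (normalise y))
  normalise-correct (x ∨ y) = begin
    close x ∨ close y                   ≈⟨ F2 _ _ ⟩
    ¬ (¬ close x ∧ ¬ close y)
      ≈⟨ ¬-cong (∧-cong (¬-normalise x (normalise-correct x)) (¬-normalise y (normalise-correct y))) ⟩
    ¬ (nfTerm ⟦_⟧ nx ∧ nfTerm ⟦_⟧ ny)   ≈⟨ ¬-cong (∧ᴺ-correct nx ny) ⟩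
    ¬ nfTerm ⟦_⟧ (nx ∧ᴺ ny)             ≈⟨ ¬ᴺ-correct (nx ∧ᴺ ny) ⟩
    nfTerm ⟦_⟧ (¬ᴺ (nx ∧ᴺ ny))          ∎
    where
    nx = ¬ᴺ (normalise x)
    ny = ¬ᴺ (normalise y)

  data Conn : Set where
    ∧ᶜ ∨ᶜ : Conn

  dual : Conn → Conn
  dual ∧ᶜ = ∨ᶜ
  dual ∨ᶜ = ∧ᶜ

  apply : Conn → Term A ℕ → Term A ℕ → Term A ℕ
  apply ∧ᶜ x y = x ∧ y
  apply ∨ᶜ x y = x ∨ y

  -- chain ℓ o (ρ₁ ∷ ρ₂ ∷ … ∷ [ ρₙ ]) is ((ℓ o ρ₁) (dual o) ρ₂) … ρₙ with alternating
  -- connectives; (φ o ρ) o ψ is stored as φ o (ρ o ψ).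
  data Canonical : Set
  data Spine : Set
  data Canonical where
    single : Literal → Canonical
    chain : Literal → Conn → Spine → Canonical
  data Spine where
    [_] : Canonical → Spine
    _∷_ : Canonical → Spine → Spine

  ⟦_⟧ᶜ : Canonical → Term A ℕ
  chainTerm : Term A ℕ → Conn → Spine → Term A ℕ
  ⟦ single ℓ ⟧ᶜ = ⟦ ℓ ⟧ˡ
  ⟦ chain ℓ o σ ⟧ᶜ = chainTerm ⟦ ℓ ⟧ˡ o σ
  chainTerm x o [ ρ ] = apply o x ⟦ ρ ⟧ᶜ
  chainTerm x o (ρ ∷ σ) = chainTerm (apply o x ⟦ ρ ⟧ᶜ) (dual o) σ

  applyᶜ : Conn → Canonical → Canonical → Canonical
  snoc : Conn → Conn → Spine → Canonical → Spine
  applyᶜ o (single ℓ) ψ = chain ℓ o [ ψ ]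
  applyᶜ o (chain ℓ o′ σ) ψ = chain ℓ o′ (snoc o o′ σ ψ)
  snoc o o′ (ρ ∷ σ) ψ = ρ ∷ snoc o (dual o′) σ ψ
  snoc ∧ᶜ ∧ᶜ [ ρ ] ψ = [ applyᶜ ∧ᶜ ρ ψ ]
  snoc ∨ᶜ ∨ᶜ [ ρ ] ψ = [ applyᶜ ∨ᶜ ρ ψ ]
  snoc ∧ᶜ ∨ᶜ [ ρ ] ψ = ρ ∷ [ ψ ]
  snoc ∨ᶜ ∧ᶜ [ ρ ] ψ = ρ ∷ [ ψ ]

  applyᶜ-correct : ∀ o φ ψ → ⟦ applyᶜ o φ ψ ⟧ᶜ ≃ apply o ⟦ φ ⟧ᶜ ⟦ ψ ⟧ᶜ
  snoc-correct : ∀ o o′ σ x ψ → chainTerm x o′ (snoc o o′ σ ψ) ≃ apply o (chainTerm x o′ σ) ⟦ ψ ⟧ᶜ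
  applyᶜ-correct o (single ℓ) ψ = refl
  applyᶜ-correct o (chain ℓ o′ σ) ψ = snoc-correct o o′ σ ⟦ ℓ ⟧ˡ ψ
  snoc-correct o o′ (ρ ∷ σ) x ψ = snoc-correct o (dual o′) σ (apply o′ x ⟦ ρ ⟧ᶜ) ψ
  snoc-correct ∧ᶜ ∧ᶜ [ ρ ] x ψ = trans (∧-cong refl (applyᶜ-correct ∧ᶜ ρ ψ)) (sym (F7 _ _ _))
  snoc-correct ∨ᶜ ∨ᶜ [ ρ ] x ψ = trans (∨-cong refl (applyᶜ-correct ∨ᶜ ρ ψ)) (sym (∨-assoc _ _ _))
  snoc-correct ∧ᶜ ∨ᶜ [ ρ ] x ψ = refl
  snoc-correct ∨ᶜ ∧ᶜ [ ρ ] x ψ = refl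

  canonical : Formula → Canonical
  canonical (lit ℓ) = single ℓ
  canonical (and x y) = applyᶜ ∧ᶜ (canonical x) (canonical y)
  canonical (or x y) = applyᶜ ∨ᶜ (canonical x) (canonical y)

  canonical-correct : ∀ x → ⟦ x ⟧ ≃ ⟦ canonical x ⟧ᶜ
  canonical-correct (lit ℓ) = refl
  canonical-correct (and x y) =
    trans (∧-cong (canonical-correct x) (canonical-correct y))
          (sym (applyᶜ-correct ∧ᶜ (canonical x) (canonical y)))
  canonical-correct (or x y) =
    trans (∨-cong (canonical-correct x) (canonical-correct y))
          (sym (applyᶜ-correct ∨ᶜ (canonical x) (canonical y)))

  mapNF : {Φ Ψ : Set} → (Φ → Ψ) → NF Φ → NF Ψ
  mapNF f (T-nf s) = T-nf s
  mapNF f (F-nf s) = F-nf s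
  mapNF f (∧-nf s φ) = ∧-nf s (f φ)

  canonicalNF : S A → NF Canonical
  canonicalNF P = mapNF canonical (normalise P)

  canonicalNF-correct : ∀ P → close P ≃ nfTerm ⟦_⟧ᶜ (canonicalNF P)
  canonicalNF-correct P = trans (normalise-correct P) (canonicalise (normalise P))
    where
    canonicalise : ∀ n → nfTerm ⟦_⟧ n ≃ nfTerm ⟦_⟧ᶜ (mapNF canonical n)
    canonicalise (T-nf s) = refl
    canonicalise (F-nf s) = refl
    canonicalise (∧-nf s x) = ∧-cong refl (canonical-correct x)

-- Uniqueness of normal forms

module Completeness (A : Set) where

  open Normalisation A

  plug : TShape → Tree A → Tree A
  plug tip K = K
  plug (branch a l r) K = node a (plug l K) (plug r K)

  literalTree : Literal → Tree A × Tree A → Tree A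
  literalTree (literal true a s t) (x , y) = node a (plug s x) (plug t y)
  literalTree (literal false a s t) (x , y) = node a (plug t y) (plug s x)

  -- exits o σ c: the trees entered after the head literal of chain ℓ o σ, on T and on F.
  canonicalTree : Canonical → Tree A × Tree A → Tree A
  exits : Conn → Spine → Tree A × Tree A → Tree A × Tree A
  exit : Conn → Canonical → Tree A × Tree A → Tree A × Tree A
  canonicalTree (single ℓ) c = literalTree ℓ c
  canonicalTree (chain ℓ o σ) c = literalTree ℓ (exits o σ c)
  exits o [ ρ ] c = exit o ρ c
  exits o (ρ ∷ σ) c = exit o ρ (exits (dual o) σ c)
  exit ∧ᶜ ρ (x , y) = canonicalTree ρ (x , y) , y
  exit ∨ᶜ ρ (x , y) = x , canonicalTree ρ (x , y)

  shape : {Φ : Set} → NF Φ → TShape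
  shape (T-nf s) = s
  shape (F-nf s) = s
  shape (∧-nf s φ) = s

  core : NF Canonical → Tree A
  core (T-nf s) = Tᵗ
  core (F-nf s) = Fᵗ
  core (∧-nf s φ) = canonicalTree φ (Tᵗ , Fᵗ)

  nfTree : NF Canonical → Tree A
  nfTree n = plug (shape n) (core n)

  module _ (γ : ℕ → Tree A) where

    eval-ᵀ-[∣] : ∀ s u v → eval γ ⌜ ⟦ s ⟧ᵀ ⌝ [ u ∣ v ] ≡ plug s u
    eval-ᵀ-[∣] tip u v = ≡.refl
    eval-ᵀ-[∣] (branch a l r) u v = ≡.cong₂ (node a)
      (≡.trans ([∣]-assoc (eval γ ⌜ ⟦ l ⟧ᵀ ⌝) Tᵗ (eval γ ⌜ ⟦ r ⟧ᵀ ⌝) u v) (eval-ᵀ-[∣] l u _))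
      (eval-ᵀ-[∣] r u v)

    eval-ᵀ-[∣]² : ∀ s u v x y → eval γ ⌜ ⟦ s ⟧ᵀ ⌝ [ u ∣ v ] [ x ∣ y ] ≡ plug s (u [ x ∣ y ])
    eval-ᵀ-[∣]² s u v x y = ≡.trans ([∣]-assoc (eval γ ⌜ ⟦ s ⟧ᵀ ⌝) u v x y) (eval-ᵀ-[∣] s _ _)

    eval-literal : ∀ ℓ x y → eval γ ⌜ ⟦ ℓ ⟧ˡ ⌝ [ x ∣ y ] ≡ literalTree ℓ (x , y)
    eval-literal (literal true a s t) x y =
      ≡.cong₂ (node a) (eval-ᵀ-[∣]² s Tᵗ _ x y) (eval-ᵀ-[∣]² t Fᵗ Fᵗ x y)
    eval-literal (literal false a s t) x y =
      ≡.cong₂ (node a) (eval-ᵀ-[∣]² t Fᵗ Fᵗ x y) (eval-ᵀ-[∣]² s Tᵗ _ x y)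

    eval-canonical : ∀ φ x y → eval γ ⌜ ⟦ φ ⟧ᶜ ⌝ [ x ∣ y ] ≡ canonicalTree φ (x , y)
    eval-chain : ∀ z o σ x y
               → eval γ ⌜ chainTerm z o σ ⌝ [ x ∣ y ] ≡ uncurry (_[_∣_] (eval γ ⌜ z ⌝)) (exits o σ (x , y))
    eval-apply : ∀ z o ρ x y
               → eval γ ⌜ apply o z ⟦ ρ ⟧ᶜ ⌝ [ x ∣ y ] ≡ uncurry (_[_∣_] (eval γ ⌜ z ⌝)) (exit o ρ (x , y))
    eval-canonical (single ℓ) x y = eval-literal ℓ x y
    eval-canonical (chain ℓ o σ) x y = ≡.trans (eval-chain ⟦ ℓ ⟧ˡ o σ x y) (eval-literal ℓ _ _)
    eval-chain z o [ ρ ] x y = eval-apply z o ρ x y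
    eval-chain z o (ρ ∷ σ) x y = ≡.trans (eval-chain (apply o z ⟦ ρ ⟧ᶜ) (dual o) σ x y) (eval-apply z o ρ _ _)
    eval-apply z ∧ᶜ ρ x y = ≡.trans ([∣]-assoc (eval γ ⌜ z ⌝) _ Fᵗ x y)
      (≡.cong (eval γ ⌜ z ⌝ [_∣ y ]) (eval-canonical ρ x y))
    eval-apply z ∨ᶜ ρ x y = ≡.trans ([∣]-assoc (eval γ ⌜ z ⌝) Tᵗ _ x y)
      (≡.cong (eval γ ⌜ z ⌝ [ x ∣_]) (eval-canonical ρ x y))

    eval-nf : ∀ n → eval γ ⌜ nfTerm ⟦_⟧ᶜ n ⌝ ≡ nfTree n
    eval-nf (T-nf s) = ≡.trans (≡.sym ([Tᵗ∣Fᵗ] _)) (eval-ᵀ-[∣] s Tᵗ Fᵗ)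
    eval-nf (F-nf s) = eval-ᵀ-[∣] s Fᵗ Fᵗ
    eval-nf (∧-nf s φ) = ≡.trans (eval-ᵀ-[∣] s _ Fᵗ)
      (≡.cong (plug s) (≡.trans (≡.sym ([Tᵗ∣Fᵗ] _)) (eval-canonical φ Tᵗ Fᵗ)))

  size : Tree A → ℕ
  size (leaf _) = 0
  size (node a l r) = suc (size l + size r)

  maxSize : Tree A × Tree A → ℕ
  maxSize (x , y) = size x ⊔ size y

  plug-size : ∀ s K → size K ≤ size (plug s K)
  plug-size tip K = ≤-refl
  plug-size (branch a l r) K = ≤-trans (plug-size l K) (≤-trans (m≤m+n _ _) (n≤1+n _))

  literalTree-grows : ∀ ℓ c → maxSize c < size (literalTree ℓ c)
  literalTree-grows (literal true a s t) (x , y) =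
    ⊔-lub (s≤s (≤-trans (plug-size s x) (m≤m+n _ _))) (s≤s (≤-trans (plug-size t y) (m≤n+m _ _)))
  literalTree-grows (literal false a s t) (x , y) =
    ⊔-lub (s≤s (≤-trans (plug-size s x) (m≤n+m _ _))) (s≤s (≤-trans (plug-size t y) (m≤m+n _ _)))

  heavy light : Conn → Tree A × Tree A → Tree A
  heavy ∧ᶜ = proj₁
  heavy ∨ᶜ = proj₂
  light ∧ᶜ = proj₂
  light ∨ᶜ = proj₁

  heavy-≤ : ∀ o c → size (heavy o c) ≤ maxSize c
  heavy-≤ ∧ᶜ c = m≤m⊔n _ _
  heavy-≤ ∨ᶜ c = m≤n⊔m _ _

  light-≤ : ∀ o c → size (light o c) ≤ maxSize c
  light-≤ ∧ᶜ c = m≤n⊔m _ _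
  light-≤ ∨ᶜ c = m≤m⊔n _ _

  -- After a run of o, the exit that receives its last operand is strictly the largest.
  Dominant : Conn → Tree A × Tree A → ℕ → Set
  Dominant o d n = size (light o d) < size (heavy o d) × n < size (heavy o d)

  dominant-< : ∀ o d {n} → Dominant o d n → n < maxSize d
  dominant-< o d (_ , n<heavy) = <-≤-trans n<heavy (heavy-≤ o d)

  dominant-maxSize : ∀ o d {n} → Dominant o d n → maxSize d ≡ size (heavy o d)
  dominant-maxSize ∧ᶜ d (light<heavy , _) = m≥n⇒m⊔n≡m (<⇒≤ light<heavy)
  dominant-maxSize ∨ᶜ d (light<heavy , _) = m≤n⇒m⊔n≡n (<⇒≤ light<heavy)

  dominant-≢ : ∀ o d {n} → Dominant o d n → proj₁ d ≢ proj₂ d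
  dominant-≢ ∧ᶜ d (light<heavy , _) eq = <-irrefl (≡.cong size (≡.sym eq)) light<heavy
  dominant-≢ ∨ᶜ d (light<heavy , _) eq = <-irrefl (≡.cong size eq) light<heavy

  dominant-∧∨ : ∀ d {m n} → Dominant ∧ᶜ d m → Dominant ∨ᶜ d n → ⊥
  dominant-∧∨ d (p , _) (q , _) = <-asym p q

  canonicalTree-grows : ∀ φ c → maxSize c < size (canonicalTree φ c)
  exits-dominant : ∀ o σ c → Dominant o (exits o σ c) (maxSize c)
  exit-dominant : ∀ o ρ c {n} → n ≤ maxSize c → Dominant o (exit o ρ c) n
  canonicalTree-grows (single ℓ) c = literalTree-grows ℓ c
  canonicalTree-grows (chain ℓ o σ) c =
    <-trans (dominant-< o _ (exits-dominant o σ c)) (literalTree-grows ℓ _)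
  exits-dominant o [ ρ ] c = exit-dominant o ρ c ≤-refl
  exits-dominant o (ρ ∷ σ) c =
    exit-dominant o ρ _ (<⇒≤ (dominant-< (dual o) _ (exits-dominant (dual o) σ c)))
  exit-dominant ∧ᶜ ρ c n≤ =
    ≤-<-trans (light-≤ ∧ᶜ c) (canonicalTree-grows ρ c) , ≤-<-trans n≤ (canonicalTree-grows ρ c)
  exit-dominant ∨ᶜ ρ c n≤ =
    ≤-<-trans (light-≤ ∨ᶜ c) (canonicalTree-grows ρ c) , ≤-<-trans n≤ (canonicalTree-grows ρ c)

  Prime : Tree A → Set
  Prime K = ∀ a l r K′ → K ≢ plug (branch a l r) K′

  leaf-prime : ∀ b → Prime (leaf b)
  leaf-prime b a l r K′ ()

  node-injective : ∀ {a a′ : A} {l l′ r r′ : Tree A} → node a l r ≡ node a′ l′ r′ → a ≡ a′ × l ≡ l′ × r ≡ r′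
  node-injective ≡.refl = ≡.refl , ≡.refl , ≡.refl

  plug-cancel : ∀ s l {K K′} → Prime K → plug s K ≡ plug l K′ → ∃ λ m → K′ ≡ plug m K
  plug-cancel tip tip pK eq = tip , ≡.sym eq
  plug-cancel tip (branch a l₁ l₂) pK eq = ⊥-elim (pK a l₁ l₂ _ eq)
  plug-cancel (branch a s₁ s₂) tip pK eq = branch a s₁ s₂ , ≡.sym eq
  plug-cancel (branch a s₁ s₂) (branch b l₁ l₂) pK eq =
    plug-cancel s₁ l₁ pK (proj₁ (proj₂ (node-injective eq)))

  plug-injective : ∀ s l {K K′} → Prime K → Prime K′ → plug s K ≡ plug l K′ → s ≡ l × K ≡ K′
  plug-injective tip tip pK pK′ eq = ≡.refl , eq
  plug-injective tip (branch a l₁ l₂) pK pK′ eq = ⊥-elim (pK a l₁ l₂ _ eq)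
  plug-injective (branch a s₁ s₂) tip pK pK′ eq = ⊥-elim (pK′ a s₁ s₂ _ (≡.sym eq))
  plug-injective (branch a s₁ s₂) (branch b l₁ l₂) pK pK′ eq =
    let a≡b , eq₁ , eq₂ = node-injective eq
        s₁≡l₁ , K≡K′ = plug-injective s₁ l₁ pK pK′ eq₁
        s₂≡l₂ , _ = plug-injective s₂ l₂ pK pK′ eq₂
    in branch-cong a≡b s₁≡l₁ s₂≡l₂ , K≡K′
    where
    branch-cong : ∀ {a b s₁ l₁ s₂ l₂} → a ≡ b → s₁ ≡ l₁ → s₂ ≡ l₂ → branch a s₁ s₂ ≡ branch b l₁ l₂
    branch-cong ≡.refl ≡.refl ≡.refl = ≡.refl

  record Apart (c : Tree A × Tree A) : Set where
    field
      prime₁ : Prime (proj₁ c)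
      prime₂ : Prime (proj₂ c)
      distinct : proj₁ c ≢ proj₂ c
  open Apart

  apart-swap : ∀ {c} → Apart c → Apart (swap c)
  apart-swap ac = record { prime₁ = prime₂ ac ; prime₂ = prime₁ ac ; distinct = λ eq → distinct ac (≡.sym eq) }

  -- A factor K common to both subtrees would force x ≡ y.
  plugs-prime : ∀ {a b s t l r K x y} → Prime x → Prime y → x ≢ y
              → node a (plug s x) (plug t y) ≢ plug (branch b l r) K
  plugs-prime {s = s} {t} {l} {r} px py x≢y eq =
    let _ , eq₁ , eq₂ = node-injective eq
        m₁ , K≡m₁x = plug-cancel s l px eq₁
        m₂ , K≡m₂y = plug-cancel t r py eq₂
    in x≢y (proj₂ (plug-injective m₁ m₂ px py (≡.trans (≡.sym K≡m₁x) K≡m₂y)))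

  literalTree-prime : ∀ ℓ {c} → Apart c → Prime (literalTree ℓ c)
  literalTree-prime (literal true a s t) ac b l r K =
    plugs-prime {l = l} {r} {K} (prime₁ ac) (prime₂ ac) (distinct ac)
  literalTree-prime (literal false a s t) ac b l r K =
    plugs-prime {l = l} {r} {K} (prime₂ ac) (prime₁ ac) (distinct (apart-swap ac))

  canonicalTree-prime : ∀ φ {c} → Apart c → Prime (canonicalTree φ c)
  exits-apart : ∀ o σ {c} → Apart c → Apart (exits o σ c)
  exit-apart : ∀ o ρ {c} → Apart c → Apart (exit o ρ c)
  canonicalTree-prime (single ℓ) ac = literalTree-prime ℓ ac
  canonicalTree-prime (chain ℓ o σ) ac = literalTree-prime ℓ (exits-apart o σ ac)
  exits-apart o [ ρ ] ac = exit-apart o ρ ac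
  exits-apart o (ρ ∷ σ) ac = exit-apart o ρ (exits-apart (dual o) σ ac)
  exit-apart ∧ᶜ ρ {c} ac = record
    { prime₁ = canonicalTree-prime ρ ac ; prime₂ = prime₂ ac
    ; distinct = dominant-≢ ∧ᶜ (exit ∧ᶜ ρ c) (exit-dominant ∧ᶜ ρ c ≤-refl) }
  exit-apart ∨ᶜ ρ {c} ac = record
    { prime₁ = prime₁ ac ; prime₂ = canonicalTree-prime ρ ac
    ; distinct = dominant-≢ ∨ᶜ (exit ∨ᶜ ρ c) (exit-dominant ∨ᶜ ρ c ≤-refl) }

  negᶜ : Canonical → Canonical
  negSpine : Spine → Spine
  negᶜ (single ℓ) = single (negˡ ℓ)
  negᶜ (chain ℓ o σ) = chain (negˡ ℓ) (dual o) (negSpine σ)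
  negSpine [ ρ ] = [ negᶜ ρ ]
  negSpine (ρ ∷ σ) = negᶜ ρ ∷ negSpine σ

  literalTree-negˡ : ∀ ℓ c → literalTree (negˡ ℓ) (swap c) ≡ literalTree ℓ c
  literalTree-negˡ (literal true a s t) c = ≡.refl
  literalTree-negˡ (literal false a s t) c = ≡.refl

  canonicalTree-negᶜ : ∀ φ c → canonicalTree (negᶜ φ) (swap c) ≡ canonicalTree φ c
  exits-negSpine : ∀ o σ c → exits (dual o) (negSpine σ) (swap c) ≡ swap (exits o σ c)
  exit-negᶜ : ∀ o ρ c → exit (dual o) (negᶜ ρ) (swap c) ≡ swap (exit o ρ c)
  canonicalTree-negᶜ (single ℓ) c = literalTree-negˡ ℓ c
  canonicalTree-negᶜ (chain ℓ o σ) c =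
    ≡.trans (≡.cong (literalTree (negˡ ℓ)) (exits-negSpine o σ c)) (literalTree-negˡ ℓ _)
  exits-negSpine o [ ρ ] c = exit-negᶜ o ρ c
  exits-negSpine o (ρ ∷ σ) c =
    ≡.trans (≡.cong (exit (dual o) (negᶜ ρ)) (exits-negSpine (dual o) σ c)) (exit-negᶜ o ρ _)
  exit-negᶜ ∧ᶜ ρ c = ≡.cong (proj₂ c ,_) (canonicalTree-negᶜ ρ c)
  exit-negᶜ ∨ᶜ ρ c = ≡.cong (_, proj₁ c) (canonicalTree-negᶜ ρ c)

  node-plug-injective : ∀ {a a′ s s′ t t′ x y x′ y′} → Prime x → Prime y → Prime x′ → Prime y′
    → node a (plug s x) (plug t y) ≡ node a′ (plug s′ x′) (plug t′ y′)
    → a ≡ a′ × s ≡ s′ × t ≡ t′ × (x , y) ≡ (x′ , y′)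
  node-plug-injective {s = s} {s′} {t} {t′} px py px′ py′ eq =
    let a≡a′ , eq₁ , eq₂ = node-injective eq
        s≡s′ , x≡x′ = plug-injective s s′ px px′ eq₁
        t≡t′ , y≡y′ = plug-injective t t′ py py′ eq₂
    in a≡a′ , s≡s′ , t≡t′ , ≡.cong₂ _,_ x≡x′ y≡y′

  literalTree-injective : ∀ ℓ ℓ′ {c d} → Apart c → Apart d → literalTree ℓ c ≡ literalTree ℓ′ d
                        → (ℓ ≡ ℓ′ × c ≡ d) ⊎ c ≡ swap d
  literalTree-injective (literal true a s t) (literal true a′ s′ t′) ac ad eq
    with node-plug-injective (prime₁ ac) (prime₂ ac) (prime₁ ad) (prime₂ ad) eq
  ... | ≡.refl , ≡.refl , ≡.refl , c≡d = inj₁ (≡.refl , c≡d)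
  literalTree-injective (literal true a s t) (literal false a′ s′ t′) ac ad eq =
    let _ , _ , _ , c≡swap = node-plug-injective (prime₁ ac) (prime₂ ac) (prime₂ ad) (prime₁ ad) eq
    in inj₂ c≡swap
  literalTree-injective (literal false a s t) (literal true a′ s′ t′) ac ad eq =
    let _ , _ , _ , swap≡d = node-plug-injective (prime₂ ac) (prime₁ ac) (prime₁ ad) (prime₂ ad) eq
    in inj₂ (≡.cong swap swap≡d)
  literalTree-injective (literal false a s t) (literal false a′ s′ t′) ac ad eq
    with node-plug-injective (prime₂ ac) (prime₁ ac) (prime₂ ad) (prime₁ ad) eq
  ... | ≡.refl , ≡.refl , ≡.refl , c≡d = inj₁ (≡.refl , ≡.cong swap c≡d)

  maxSize-swap : ∀ c → maxSize (swap c) ≡ maxSize c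
  maxSize-swap (x , y) = ⊔-comm (size y) (size x)

  exits-grows : ∀ o σ c → maxSize c < maxSize (exits o σ c)
  exits-grows o σ c = dominant-< o _ (exits-dominant o σ c)

  exits-maxSize : ∀ o σ c → maxSize (exits (dual o) σ c) ≡ size (light o (exits (dual o) σ c))
  exits-maxSize ∧ᶜ σ c = dominant-maxSize ∨ᶜ _ (exits-dominant ∨ᶜ σ c)
  exits-maxSize ∨ᶜ σ c = dominant-maxSize ∧ᶜ _ (exits-dominant ∧ᶜ σ c)

  exit-light : ∀ o ρ ρ′ {d d′} → exit o ρ d ≡ exit o ρ′ d′ → light o d ≡ light o d′
  exit-light ∧ᶜ ρ ρ′ eq = ≡.cong proj₂ eq
  exit-light ∨ᶜ ρ ρ′ eq = ≡.cong proj₁ eq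

  sharing-excludes-swap : ∀ {c c′ : Tree A × Tree A} → proj₁ c′ ≢ proj₂ c′
                        → (proj₁ c ≡ proj₁ c′ ⊎ proj₂ c ≡ proj₂ c′) → c ≢ swap c′
  sharing-excludes-swap c′₁≢c′₂ (inj₁ eq₁) c≡swap = c′₁≢c′₂ (≡.trans (≡.sym eq₁) (≡.cong proj₁ c≡swap))
  sharing-excludes-swap c′₁≢c′₂ (inj₂ eq₂) c≡swap = c′₁≢c′₂ (≡.trans (≡.sym (≡.cong proj₂ c≡swap)) eq₂)

  literalTree-maxSize : ∀ ℓ ℓ′ {c d} → Apart c → Apart d → literalTree ℓ c ≡ literalTree ℓ′ d
                      → maxSize c ≡ maxSize d
  literalTree-maxSize ℓ ℓ′ {d = d} ac ad eq with literalTree-injective ℓ ℓ′ ac ad eq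
  ... | inj₁ (_ , c≡d) = ≡.cong maxSize c≡d
  ... | inj₂ c≡swap = ≡.trans (≡.cong maxSize c≡swap) (maxSize-swap d)

  literal-vs-chain : ∀ ℓ ℓ′ o σ {c c′} → Apart c → Apart c′ → maxSize c ≡ maxSize c′
                   → literalTree ℓ c ≢ literalTree ℓ′ (exits o σ c′)
  literal-vs-chain ℓ ℓ′ o σ {c} {c′} ac ac′ size≡ eq =
    <-irrefl (≡.trans (≡.sym size≡) (literalTree-maxSize ℓ ℓ′ ac (exits-apart o σ ac′) eq)) (exits-grows o σ c′)

  exit-vs-exits : ∀ o ρ ρ′ σ′ {c c′} → maxSize c ≡ maxSize c′ → exit o ρ c ≢ exit o ρ′ (exits (dual o) σ′ c′)
  exit-vs-exits o ρ ρ′ σ′ {c} {c′} size≡ eq =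
    n≮n _ (begin-strict
      maxSize c′                                   <⟨ exits-grows (dual o) σ′ c′ ⟩
      maxSize (exits (dual o) σ′ c′)               ≡⟨ exits-maxSize o σ′ c′ ⟩
      size (light o (exits (dual o) σ′ c′))        ≡⟨ ≡.cong size (≡.sym (exit-light o ρ ρ′ eq)) ⟩
      size (light o c)                             ≤⟨ light-≤ o c ⟩
      maxSize c                                    ≡⟨ size≡ ⟩
      maxSize c′                                   ∎)
    where open ≤-Reasoning

  exits-conn : ∀ o σ o′ σ′ {c c′} → exits o σ c ≡ exits o′ σ′ c′ → o ≡ o′
  exits-conn ∧ᶜ σ ∧ᶜ σ′ eq = ≡.refl
  exits-conn ∨ᶜ σ ∨ᶜ σ′ eq = ≡.refl
  exits-conn ∧ᶜ σ ∨ᶜ σ′ {c} {c′} eq = ⊥-elim (dominant-∧∨ _ (exits-dominant ∧ᶜ σ c)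
    (≡.subst (λ d → Dominant ∨ᶜ d (maxSize c′)) (≡.sym eq) (exits-dominant ∨ᶜ σ′ c′)))
  exits-conn ∨ᶜ σ ∧ᶜ σ′ {c} {c′} eq = ⊥-elim (dominant-∧∨ _ (exits-dominant ∧ᶜ σ′ c′)
    (≡.subst (λ d → Dominant ∨ᶜ d (maxSize c)) eq (exits-dominant ∨ᶜ σ c)))

  tails-maxSize : ∀ o ρ ρ′ σ σ′ {c c′} → exit o ρ (exits (dual o) σ c) ≡ exit o ρ′ (exits (dual o) σ′ c′)
                → maxSize (exits (dual o) σ c) ≡ maxSize (exits (dual o) σ′ c′)
  tails-maxSize o ρ ρ′ σ σ′ {c} {c′} eq =
    ≡.trans (exits-maxSize o σ c) (≡.trans (≡.cong size (exit-light o ρ ρ′ eq)) (≡.sym (exits-maxSize o σ′ c′)))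

  -- The hypotheses on c, c′ are what is known when comparing the last operands of equal runs:
  -- the light exits coincide, and so do the sizes of the dominant ones.
  canonicalTree-injective : ∀ φ ψ {c c′} → Apart c → Apart c′
    → (proj₁ c ≡ proj₁ c′ ⊎ proj₂ c ≡ proj₂ c′) → maxSize c ≡ maxSize c′
    → canonicalTree φ c ≡ canonicalTree ψ c′ → φ ≡ ψ × c ≡ c′
  exits-injective : ∀ o σ o′ σ′ {c c′} → Apart c → Apart c′ → maxSize c ≡ maxSize c′
    → exits o σ c ≡ exits o′ σ′ c′ → (o ≡ o′ × σ ≡ σ′) × c ≡ c′
  spine-injective : ∀ o σ σ′ {c c′} → Apart c → Apart c′ → maxSize c ≡ maxSize c′
    → exits o σ c ≡ exits o σ′ c′ → σ ≡ σ′ × c ≡ c′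
  exit-injective : ∀ o ρ ρ′ {c c′} → Apart c → Apart c′ → maxSize c ≡ maxSize c′
    → exit o ρ c ≡ exit o ρ′ c′ → ρ ≡ ρ′ × c ≡ c′

  canonicalTree-injective (single ℓ) (single ℓ′) ac ac′ shared size≡ eq
    with literalTree-injective ℓ ℓ′ ac ac′ eq
  ... | inj₁ (≡.refl , c≡c′) = ≡.refl , c≡c′
  ... | inj₂ c≡swap = ⊥-elim (sharing-excludes-swap (distinct ac′) shared c≡swap)
  canonicalTree-injective (single ℓ) (chain ℓ′ o′ σ′) ac ac′ shared size≡ eq =
    ⊥-elim (literal-vs-chain ℓ ℓ′ o′ σ′ ac ac′ size≡ eq)
  canonicalTree-injective (chain ℓ o σ) (single ℓ′) ac ac′ shared size≡ eq =
    ⊥-elim (literal-vs-chain ℓ′ ℓ o σ ac′ ac (≡.sym size≡) (≡.sym eq))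
  canonicalTree-injective (chain ℓ o σ) (chain ℓ′ o′ σ′) {c} {c′} ac ac′ shared size≡ eq
    with literalTree-injective ℓ ℓ′ (exits-apart o σ ac) (exits-apart o′ σ′ ac′) eq
  ... | inj₂ d≡swap = ⊥-elim (sharing-excludes-swap (distinct ac′) shared (proj₂
          (exits-injective o σ (dual o′) (negSpine σ′) ac (apart-swap ac′)
             (≡.trans size≡ (≡.sym (maxSize-swap c′)))
             (≡.trans d≡swap (≡.sym (exits-negSpine o′ σ′ c′))))))
  ... | inj₁ (≡.refl , d≡d′) with exits-injective o σ o′ σ′ ac ac′ size≡ d≡d′
  ...   | (≡.refl , ≡.refl) , c≡c′ = ≡.refl , c≡c′

  exits-injective o σ o′ σ′ ac ac′ size≡ eq with exits-conn o σ o′ σ′ eq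
  ... | ≡.refl = map₁ (≡.refl ,_) (spine-injective o σ σ′ ac ac′ size≡ eq)

  spine-injective o [ ρ ] [ ρ′ ] ac ac′ size≡ eq = map₁ (≡.cong [_]) (exit-injective o ρ ρ′ ac ac′ size≡ eq)
  spine-injective o [ ρ ] (ρ′ ∷ σ′) ac ac′ size≡ eq = ⊥-elim (exit-vs-exits o ρ ρ′ σ′ size≡ eq)
  spine-injective o (ρ ∷ σ) [ ρ′ ] ac ac′ size≡ eq = ⊥-elim (exit-vs-exits o ρ′ ρ σ (≡.sym size≡) (≡.sym eq))
  spine-injective o (ρ ∷ σ) (ρ′ ∷ σ′) ac ac′ size≡ eq
    with exit-injective o ρ ρ′ (exits-apart (dual o) σ ac) (exits-apart (dual o) σ′ ac′)
           (tails-maxSize o ρ ρ′ σ σ′ eq) eq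
  ... | ≡.refl , d≡d′ with spine-injective (dual o) σ σ′ ac ac′ size≡ d≡d′
  ...   | ≡.refl , c≡c′ = ≡.refl , c≡c′

  exit-injective ∧ᶜ ρ ρ′ ac ac′ size≡ eq =
    canonicalTree-injective ρ ρ′ ac ac′ (inj₂ (≡.cong proj₂ eq)) size≡ (≡.cong proj₁ eq)
  exit-injective ∨ᶜ ρ ρ′ ac ac′ size≡ eq =
    canonicalTree-injective ρ ρ′ ac ac′ (inj₁ (≡.cong proj₁ eq)) size≡ (≡.cong proj₂ eq)

  T-F-apart : Apart (Tᵗ , Fᵗ)
  T-F-apart = record { prime₁ = leaf-prime true ; prime₂ = leaf-prime false ; distinct = λ () }

  core-prime : ∀ n → Prime (core n)
  core-prime (T-nf s) = leaf-prime true
  core-prime (F-nf s) = leaf-prime false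
  core-prime (∧-nf s φ) = canonicalTree-prime φ T-F-apart

  canonicalTree-node : ∀ φ c b → canonicalTree φ c ≢ leaf b
  canonicalTree-node φ c b eq = n≮0 (≡.subst (λ t → maxSize c < size t) eq (canonicalTree-grows φ c))

  core-injective : ∀ n m → shape n ≡ shape m → core n ≡ core m → n ≡ m
  core-injective (T-nf s) (T-nf _) ≡.refl _ = ≡.refl
  core-injective (F-nf s) (F-nf _) ≡.refl _ = ≡.refl
  core-injective (∧-nf s φ) (∧-nf _ ψ) ≡.refl eq =
    ≡.cong (∧-nf s) (proj₁ (canonicalTree-injective φ ψ T-F-apart T-F-apart (inj₁ ≡.refl) ≡.refl eq))
  core-injective (T-nf s) (F-nf u) _ ()
  core-injective (F-nf s) (T-nf u) _ ()
  core-injective (T-nf s) (∧-nf u ψ) _ eq = ⊥-elim (canonicalTree-node ψ _ true (≡.sym eq))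
  core-injective (F-nf s) (∧-nf u ψ) _ eq = ⊥-elim (canonicalTree-node ψ _ false (≡.sym eq))
  core-injective (∧-nf s φ) (T-nf u) _ eq = ⊥-elim (canonicalTree-node φ _ true eq)
  core-injective (∧-nf s φ) (F-nf u) _ eq = ⊥-elim (canonicalTree-node φ _ false eq)

  nfTree-injective : ∀ n m → nfTree n ≡ nfTree m → n ≡ m
  nfTree-injective n m eq =
    let shape≡ , core≡ = plug-injective (shape n) (shape m) (core-prime n) (core-prime m) eq
    in core-injective n m shape≡ core≡

  completeness : ∀ P Q → ⌜ close P ⌝ ≅ ⌜ close Q ⌝ → close P ≃ close Q
  completeness P Q P≅Q =
    trans (canonicalNF-correct P)
          (≡.subst (_≃ close Q) (≡.cong (nfTerm ⟦_⟧ᶜ) (≡.sym same-nf)) (sym (canonicalNF-correct Q)))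
    where
    γ : ℕ → Tree A
    γ _ = Tᵗ
    tree : ∀ R → eval γ ⌜ close R ⌝ ≡ nfTree (canonicalNF R)
    tree R = ≡.trans (eval-sound γ (soundness (canonicalNF-correct R))) (eval-nf γ (canonicalNF R))
    same-nf : canonicalNF P ≡ canonicalNF Q
    same-nf = nfTree-injective _ _ (≡.trans (≡.sym (tree P)) (≡.trans (eval-sound γ P≅Q) (tree Q)))

theorem4p3 : (A : Set) → A → (P Q : S A)
    → (EqFSCL⊢ close P ≈ close Q) ⇔ (FSCL⊢ ⌜ close P ⌝ ≈ ⌜ close Q ⌝)
theorem4p3 A _ P Q = mk⇔ soundness (Completeness.completeness A P Q)
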